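{- Let $r\ge 2$ and let $C_1,\ldots,C_r$ be finite sets. Then $$\sum_{\pi=(i_1,\ldots,i_r) \in S_{r}}|C_{i_1}\cap C_{i_2}|\,|C_{i_2}\cap C_{i_3}|\cdots|C_{i_{r-1}}\cap C_{i_r}|\leq\left(\frac{2\sum_{1\le i<j\le r}|C_i\cap C_j|+r}{r}\right)^r,$$ where the sum is over all permutations $(i_1,\ldots,i_r)$ of $(1,2,\ldots,r)$.
   Context: $S_r$ denotes the set of all permutations of $(1,2,\ldots,r)$. -}

module Defs where

open import Data.Nat using (ℕ; zero; suc; _+_; _*_; _<_; _≤_; _<ᵇ_; s≤s; z≤n; NonZero; >-nonZero)
open import Data.Nat.Properties using (≤-trans)
open import Data.Fin using (Fin; toℕ; _≟_)
open import Data.Fin.Subset using (Subset; _∩_; ∣_∣)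
open import Data.Nat.ListAction using (sum)
open import Data.List using (List; []; _∷_; map; filter; concatMap; allFin; cartesianProduct)
import Data.List.Relation.Unary.Unique.DecPropositional
open import Data.Product using (_×_; _,_)
open import Relation.Nullary.Decidable using (T?)
open import Data.Integer using (+_)
open import Data.Rational using (ℚ; _/_; 1ℚ) renaming (_*_ to _*ℚ_)

tuples : (r k : ℕ) → List (List (Fin r))
tuples r zero    = [] ∷ []
tuples r (suc k) = concatMap (λ i → map (i ∷_) (tuples r k)) (allFin r)

-- S_r : all permutations (i₁,…,i_r) of (1,…,r), i.e. the length-r tuples
-- over Fin r with pairwise distinct entries (each listed exactly once).
permutations : (r : ℕ) → List (List (Fin r))
permutations r = filter (Data.List.Relation.Unary.Unique.DecPropositional.unique? _≟_) (tuples r r)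

chainProduct : {r n : ℕ} → (Fin r → Subset n) → List (Fin r) → ℕ
chainProduct C (i ∷ j ∷ is) = ∣ C i ∩ C j ∣ * chainProduct C (j ∷ is)
chainProduct C _            = 1

permSum : {r n : ℕ} → (Fin r → Subset n) → ℕ
permSum {r} C = sum (map (chainProduct C) (permutations r))

pairSum : {r n : ℕ} → (Fin r → Subset n) → ℕ
pairSum {r} C =
  sum (map (λ { (i , j) → ∣ C i ∩ C j ∣ })
           (filter (λ { (i , j) → T? (toℕ i <ᵇ toℕ j) })
                   (cartesianProduct (allFin r) (allFin r))))

_^ℚ_ : ℚ → ℕ → ℚ
q ^ℚ zero  = 1ℚ
q ^ℚ suc k = q *ℚ (q ^ℚ k)

divBy : (m r : ℕ) → 2 ≤ r → ℚ
divBy m r h = _/_ (+ m) r {{>-nonZero (≤-trans (s≤s z≤n) h)}}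

ℕtoℚ : ℕ → ℚ
ℕtoℚ n = + n / 1

module Submission where

-- Write w i j = |C_i ∩ C_j|.  A permutation π, read as a path through the
-- vertices 1 … r, is determined by its successor map next_π : i ↦ the vertex
-- after i (or nothing for the last one), and its weight factorises over the
-- vertices as ∏_i stepWeight i (next_π i), with stepWeight i nothing = 1 and
-- stepWeight i (just j) = w i j for j ≠ i (0 for j = i).  Since π ↦ next_π is
-- injective, the sum over S_r is at most the sum over ALL maps
-- Fin r → Maybe (Fin r), which by distributivity equals
-- ∏_i (1 + ∑_{j≠i} w i j).  AM-GM bounds this product by (x/r)^r where
-- x = ∑_i (1 + ∑_{j≠i} w i j) = 2 ∑_{i<j} w i j + r by symmetry of w.

open import Defs
open import Data.Nat using (ℕ; _≤_; _+_; _*_)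
open import Data.Fin using (Fin)
open import Data.Fin.Subset using (Subset)
open import Data.Rational using () renaming (_≤_ to _≤ℚ_)

open import Data.Fin.Subset using (_∩_; ∣_∣)
open import Data.Fin.Subset.Properties using (∩-comm)

open import Data.Nat using (zero; suc; _^_; _<_; _<ᵇ_; NonZero; >-nonZero; z≤n; s≤s)
open import Data.Nat.Properties hiding (_≟_)
open import Data.Nat.Tactic.RingSolver using (solve-∀)
open import Data.Fin using (zero; suc; toℕ; _≟_)
open import Data.Vec using (Vec)
import Data.Vec as Vec
import Data.Vec.Properties as Vec
open import Data.Nat.ListAction using (sum)
open import Data.Nat.ListAction.Properties using (sum-++)
open import Data.List using (List; []; _∷_; _++_; head; length; map; concatMap; allFin; filter; tabulate; cartesianProductWith; cartesianProduct)
import Data.List.Properties as List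
open import Data.List.Membership.Propositional using (_∈_; _∉_)
open import Data.List.Relation.Unary.Any using (here; there)
open import Data.List.Membership.Propositional.Properties
  using (∈-allFin; ∈-map⁺; ∈-filter⁻; ∈-cartesianProductWith⁺; ∈-cartesianProductWith⁻)
open import Data.List.Relation.Unary.Unique.Propositional using (Unique)
open import Data.List.Relation.Unary.AllPairs using (_∷_)
open import Data.List.Relation.Unary.Unique.Propositional.Properties
  using (Unique[x∷xs]⇒x∉xs; filter⁺; allFin⁺; cartesianProductWith⁺)
import Data.List.Relation.Unary.AllPairs as AllPairs
import Data.List.Relation.Unary.All as All
import Data.List.Membership.DecPropositional as DecMembership
open import Data.Bool using (true; false; T; if_then_else_)
open import Data.Unit using (tt)
open import Data.Empty using (⊥-elim)
open import Relation.Nullary using (yes; no; does)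
open import Relation.Unary using (Pred; Decidable)
open import Relation.Binary.Definitions using (DecidableEquality; tri<; tri≈; tri>)
open import Function using (_∘_)
open import Level using (0ℓ)
open import Data.Sum using (inj₁; inj₂)
open import Data.Product using (_,_; ∃; proj₁; proj₂)
open import Data.Maybe using (Maybe; just; nothing)
import Data.Maybe.Properties as Maybe
import Data.Fin.Properties as Fin
open import Relation.Binary.PropositionalEquality
open import Algebra.Properties.CommutativeMonoid.Sum +-0-commutativeMonoid
  using (∑-distrib-+; ∑-comm; sum-cong-≗) renaming (sum to ∑)
open import Algebra.Properties.CommutativeMonoid.Sum *-1-commutativeMonoid
  using () renaming (sum to ∏; sum-cong-≗ to ∏-cong-≗; sum-replicate-zero to ∏-ones)

rearrangement : ∀ a b c d → a ≤ b → c ≤ d → a * d + b * c ≤ a * c + b * d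
rearrangement a b c d a≤b c≤d with m≤n⇒∃[o]m+o≡n a≤b | m≤n⇒∃[o]m+o≡n c≤d
... | p , refl | q , refl =
  subst (a * (c + q) + (a + p) * c ≤_) (expand a p c q) (m≤m+n _ (p * q))
  where
  expand : ∀ a p c q → a * (c + q) + (a + p) * c + p * q ≡ a * c + (a + p) * (c + q)
  expand = solve-∀

-- y ↦ y and y ↦ y^(m+1) are similarly ordered, hence
-- y^(m+1) z + y z^(m+1) ≤ y^(m+2) + z^(m+2).
powerRearrangement : ∀ m y z → y ^ suc m * z + y * z ^ suc m ≤ y ^ suc (suc m) + z ^ suc (suc m)
powerRearrangement m y z with ≤-total y z
... | inj₁ y≤z = subst₂ _≤_ (ordered y z (y ^ suc m) (z ^ suc m)) refl
                   (rearrangement y z (y ^ suc m) (z ^ suc m) y≤z (^-monoˡ-≤ (suc m) y≤z))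
  where
  ordered : ∀ y z s t → y * t + z * s ≡ s * z + y * t
  ordered = solve-∀
... | inj₂ z≤y = subst₂ _≤_ (ordered y z (y ^ suc m) (z ^ suc m)) (+-comm (z ^ suc (suc m)) _)
                   (rearrangement z y (z ^ suc m) (y ^ suc m) z≤y (^-monoˡ-≤ (suc m) z≤y))
  where
  ordered : ∀ y z s t → z * s + y * t ≡ s * z + y * t
  ordered = solve-∀

weightedAMGM : ∀ m y z → suc m * y * z ^ m ≤ y ^ suc m + m * z ^ suc m
weightedAMGM zero y z = ≤-reflexive (base y)
  where
  base : ∀ y → 1 * y * 1 ≡ y * 1 + 0
  base = solve-∀
weightedAMGM (suc m) y z = +-cancelˡ-≤ (y * s * z) _ _ (begin
    y * s * z + (2 + m) * y * (z * t)                       ≡⟨ split y z s t m ⟩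
    (y * s * z + y * (z * t)) + (1 + m) * y * t * z         ≤⟨ +-mono-≤ (powerRearrangement m y z)
                                                                        (*-monoˡ-≤ z (weightedAMGM m y z)) ⟩
    (y * (y * s) + z * (z * t)) + (y * s + m * (z * t)) * z ≡⟨ regroup y z s t m ⟩
    y * s * z + (y * (y * s) + (1 + m) * (z * (z * t)))     ∎)
  where
  open ≤-Reasoning
  s = y ^ m
  t = z ^ m
  split : ∀ y z s t m → y * s * z + (2 + m) * y * (z * t)
                      ≡ (y * s * z + y * (z * t)) + (1 + m) * y * t * z
  split = solve-∀
  regroup : ∀ y z s t m → (y * (y * s) + z * (z * t)) + (y * s + m * (z * t)) * z
                        ≡ y * s * z + (y * (y * s) + (1 + m) * (z * (z * t)))
  regroup = solve-∀

^-distribʳ-* : ∀ a b n → (a * b) ^ n ≡ a ^ n * b ^ n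
^-distribʳ-* a b zero = refl
^-distribʳ-* a b (suc n) = trans (cong ((a * b) *_) (^-distribʳ-* a b n)) (swap a b (a ^ n) (b ^ n))
  where
  swap : ∀ a b p q → a * b * (p * q) ≡ a * p * (b * q)
  swap = solve-∀

-- The inductive step of AM-GM: adding a number x to n numbers with sum S.
-- For n = N ≥ 1 it is weightedAMGM N applied to y = N (S+x), z = (N+1) S.
amgmStep : ∀ n S x → suc n ^ suc n * S ^ n * x ≤ n ^ n * (S + x) ^ suc n
amgmStep zero S x = subst₂ _≤_ (sym (lhs x)) (sym (rhs S x)) (m≤n+m x S)
  where
  lhs : ∀ x → (1 * 1) * 1 * x ≡ x
  lhs = solve-∀
  rhs : ∀ S x → 1 * ((S + x) * 1) ≡ S + x
  rhs = solve-∀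
amgmStep (suc k) S x = *-cancelˡ-≤ (N * suc N) (begin
    N * suc N * (suc N ^ suc N * S ^ N * x)  ≡⟨ pull N (suc N ^ N) (S ^ N) x ⟩
    suc N * (suc N ^ N * S ^ N * (N * suc N * x))
      ≡⟨ cong (λ w → suc N * (w * (N * suc N * x))) (sym (^-distribʳ-* (suc N) S N)) ⟩
    suc N * (z ^ N * (N * suc N * x))        ≤⟨ *-monoʳ-≤ (suc N) twoTerm ⟩
    suc N * y ^ suc N                        ≡⟨ cong (λ w → suc N * (y * w)) (^-distribʳ-* N (S + x) N) ⟩
    suc N * (N * (S + x) * (N ^ N * (S + x) ^ N)) ≡⟨ push N (S + x) (N ^ N) ((S + x) ^ N) ⟩
    N * suc N * (N ^ N * (S + x) ^ suc N)    ∎)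
  where
  open ≤-Reasoning
  N = suc k
  y = N * (S + x)
  z = suc N * S
  pull : ∀ N a b x → N * suc N * (suc N * a * b * x) ≡ suc N * (a * b * (N * suc N * x))
  pull = solve-∀
  push : ∀ N Q a b → suc N * (N * Q * (a * b)) ≡ N * suc N * (a * (Q * b))
  push = solve-∀
  weights : ∀ N S x zN → zN * (N * suc N * x) + N * (suc N * S * zN) ≡ suc N * (N * (S + x)) * zN
  weights = solve-∀
  twoTerm : z ^ N * (N * suc N * x) ≤ y ^ suc N
  twoTerm = +-cancelʳ-≤ (N * z ^ suc N) _ _
    (subst (_≤ y ^ suc N + N * z ^ suc N) (sym (weights N S x (z ^ N))) (weightedAMGM N y z))

amgm : ∀ n (f : Fin n → ℕ) → n ^ n * ∏ f ≤ ∑ f ^ n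
amgm zero f = ≤-refl
amgm (suc n) f = *-cancelˡ-≤ (n ^ n) {{nonZero n}} (begin
    n ^ n * (suc n ^ suc n * (x * P))  ≡⟨ shuffle (n ^ n) (suc n ^ suc n) x P ⟩
    suc n ^ suc n * x * (n ^ n * P)    ≤⟨ *-monoʳ-≤ (suc n ^ suc n * x) (amgm n (λ i → f (suc i))) ⟩
    suc n ^ suc n * x * S ^ n          ≡⟨ *-comm-last (suc n ^ suc n) x (S ^ n) ⟩
    suc n ^ suc n * S ^ n * x          ≤⟨ amgmStep n S x ⟩
    n ^ n * (S + x) ^ suc n            ≡⟨ cong (λ w → n ^ n * w ^ suc n) (+-comm S x) ⟩
    n ^ n * (x + S) ^ suc n            ∎)
  where
  open ≤-Reasoning
  x = f zero
  P = ∏ (λ i → f (suc i))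
  S = ∑ (λ i → f (suc i))
  nonZero : ∀ n → NonZero (n ^ n)
  nonZero zero = _
  nonZero (suc n) = m^n≢0 (suc n) (suc n)
  shuffle : ∀ a b x P → a * (b * (x * P)) ≡ b * x * (a * P)
  shuffle = solve-∀
  *-comm-last : ∀ b x s → b * x * s ≡ b * s * x
  *-comm-last = solve-∀

sum-map-*ˡ : ∀ {A : Set} c (f : A → ℕ) xs → sum (map (λ x → c * f x) xs) ≡ c * sum (map f xs)
sum-map-*ˡ c f []       = sym (*-zeroʳ c)
sum-map-*ˡ c f (x ∷ xs) = trans (cong (c * f x +_) (sum-map-*ˡ c f xs)) (sym (*-distribˡ-+ c (f x) _))

sum-map-*ʳ : ∀ {A : Set} c (f : A → ℕ) xs → sum (map (λ x → f x * c) xs) ≡ sum (map f xs) * c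
sum-map-*ʳ c f []       = refl
sum-map-*ʳ c f (x ∷ xs) = trans (cong (f x * c +_) (sum-map-*ʳ c f xs)) (sym (*-distribʳ-+ c (f x) _))

sum-cartesianProductWith : ∀ {A B C : Set} (g : A → B → C) (h : C → ℕ) xs ys →
  sum (map h (cartesianProductWith g xs ys)) ≡ sum (map (λ x → sum (map (λ y → h (g x y)) ys)) xs)
sum-cartesianProductWith g h []       ys = refl
sum-cartesianProductWith g h (x ∷ xs) ys = begin
    sum (map h (map (g x) ys ++ cartesianProductWith g xs ys))
      ≡⟨ cong sum (List.map-++ h (map (g x) ys) _) ⟩
    sum (map h (map (g x) ys) ++ map h (cartesianProductWith g xs ys))
      ≡⟨ sum-++ (map h (map (g x) ys)) _ ⟩
    sum (map h (map (g x) ys)) + sum (map h (cartesianProductWith g xs ys))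
      ≡⟨ cong₂ _+_ (cong sum (sym (List.map-∘ ys))) (sum-cartesianProductWith g h xs ys) ⟩
    sum (map (h ∘ g x) ys) + sum (map (λ x → sum (map (λ y → h (g x y)) ys)) xs) ∎
  where open ≡-Reasoning

sum-allFin : ∀ {n} (f : Fin n → ℕ) → sum (map f (allFin n)) ≡ ∑ f
sum-allFin {n} f = trans (cong sum (List.map-tabulate (λ i → i) f)) (sum-tabulate f)
  where
  sum-tabulate : ∀ {n} (f : Fin n → ℕ) → sum (tabulate f) ≡ ∑ f
  sum-tabulate {zero}  f = refl
  sum-tabulate {suc n} f = cong (f zero +_) (sum-tabulate (f ∘ suc))

sum-filter : ∀ {A : Set} {P : Pred A 0ℓ} (P? : Decidable P) (f : A → ℕ) xs →
  sum (map f (filter P? xs)) ≡ sum (map (λ x → if does (P? x) then f x else 0) xs)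
sum-filter P? f [] = refl
sum-filter P? f (x ∷ xs) with does (P? x)
... | true  = cong (f x +_) (sum-filter P? f xs)
... | false = sum-filter P? f xs

-- Each term
-- of L is matched with an occurrence in G, which is then deleted from G.
module _ {B : Set} (_≟B_ : DecidableEquality B) where

  delete : B → List B → List B
  delete b [] = []
  delete b (c ∷ cs) with b ≟B c
  ... | yes _ = cs
  ... | no _  = c ∷ delete b cs

  sum-delete : (h : B → ℕ) {b : B} (G : List B) → b ∈ G →
    sum (map h G) ≡ h b + sum (map h (delete b G))
  sum-delete h {b} (c ∷ cs) b∈ with b ≟B c
  ... | yes refl = refl
  sum-delete h {b} (c ∷ cs) (here refl) | no b≢c = ⊥-elim (b≢c refl)
  sum-delete h {b} (c ∷ cs) (there b∈)  | no b≢c =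
    trans (cong (h c +_) (sum-delete h cs b∈)) (+-exchange (h c) (h b) _)
    where
    +-exchange : ∀ x y z → x + (y + z) ≡ y + (x + z)
    +-exchange = solve-∀

  ∈-delete : ∀ {y b} (G : List B) → y ∈ G → y ≢ b → y ∈ delete b G
  ∈-delete {y} {b} (c ∷ cs) y∈ y≢b with b ≟B c
  ∈-delete (c ∷ cs) (here refl) y≢b | yes refl = ⊥-elim (y≢b refl)
  ∈-delete (c ∷ cs) (there y∈)  y≢b | yes refl = y∈
  ∈-delete (c ∷ cs) (here refl) y≢b | no _     = here refl
  ∈-delete (c ∷ cs) (there y∈)  y≢b | no _     = there (∈-delete cs y∈ y≢b)

  sum-≤-injection : {A : Set} (f : A → ℕ) (h : B → ℕ) (e : A → B) (L : List A) (G : List B) →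
    Unique L → (∀ {x y} → x ∈ L → y ∈ L → e x ≡ e y → x ≡ y) →
    (∀ {x} → x ∈ L → e x ∈ G) → (∀ {x} → x ∈ L → f x ≤ h (e x)) →
    sum (map f L) ≤ sum (map h G)
  sum-≤-injection f h e []      G _ _ _ _ = z≤n
  sum-≤-injection f h e (x ∷ L) G uniq@(_ ∷ uniqL) inj into le =
    subst (f x + sum (map f L) ≤_) (sym (sum-delete h G (into (here refl))))
      (+-mono-≤ (le (here refl))
        (sum-≤-injection f h e L (delete (e x) G) uniqL
          (λ p q → inj (there p) (there q))
          (λ y∈ → ∈-delete G (into (there y∈)) (λ ey≡ex → x∉L (subst (_∈ L) (inj (there y∈) (here refl) ey≡ex) y∈)))
          (le ∘ there)))
    where
    x∉L : x ∉ L
    x∉L = Unique[x∷xs]⇒x∉xs uniq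

module _ {r : ℕ} where

  next : List (Fin r) → Fin r → Maybe (Fin r)
  next []      i = nothing
  next (x ∷ t) i with x ≟ i
  ... | yes _ = head t
  ... | no _  = next t i

  next-self : ∀ x t → next (x ∷ t) x ≡ head t
  next-self x t with x ≟ x
  ... | yes _  = refl
  ... | no x≢x = ⊥-elim (x≢x refl)

  next-other : ∀ {x i} t → x ≢ i → next (x ∷ t) i ≡ next t i
  next-other {x} {i} t x≢i with x ≟ i
  ... | yes x≡i = ⊥-elim (x≢i x≡i)
  ... | no _    = refl

  next-∉ : ∀ {i} t → i ∉ t → next t i ≡ nothing
  next-∉ []      _  = refl
  next-∉ {i} (x ∷ t) i∉ with x ≟ i
  ... | yes refl = ⊥-elim (i∉ (here refl))
  ... | no _     = next-∉ t (i∉ ∘ there)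

  next-target : ∀ {p x} t → next t p ≡ just x → x ∈ t
  next-target {p} (y ∷ t) eq with y ≟ p
  next-target (y ∷ z ∷ t) refl | yes _ = there (here refl)
  ... | no _ = there (next-target t eq)

  next-source : ∀ {p x} t → next t p ≡ just x → p ∈ t
  next-source {p} (y ∷ t) eq with y ≟ p
  ... | yes refl = here refl
  ... | no _     = there (next-source t eq)

  head-no-predecessor : ∀ x t p → Unique (x ∷ t) → next (x ∷ t) p ≢ just x
  head-no-predecessor x t p uniq eq with x ≟ p
  ... | yes refl = headNotSelf t uniq eq
    where
    headNotSelf : ∀ t → Unique (x ∷ t) → head t ≢ just x
    headNotSelf (z ∷ w) uniq refl = Unique[x∷xs]⇒x∉xs uniq (here refl)
  ... | no x≢p = Unique[x∷xs]⇒x∉xs uniq (next-target t eq)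

  predecessor : ∀ y t x → Unique (y ∷ t) → x ∈ t → ∃ λ p → next (y ∷ t) p ≡ just x
  predecessor y (z ∷ w) x uniq (here refl) = y , next-self y (x ∷ w)
  predecessor y (z ∷ w) x uniq@(_ ∷ uniq') (there x∈w) with predecessor z w x uniq' x∈w
  ... | p , eq = p , trans (next-other (z ∷ w) y≢p) eq
    where
    y≢p : y ≢ p
    y≢p y≡p = Unique[x∷xs]⇒x∉xs uniq (subst (_∈ z ∷ w) (sym y≡p) (next-source (z ∷ w) eq))

  next-injective : ∀ (s s' : List (Fin r)) → Unique s → Unique s' →
    (∀ i → i ∈ s → i ∈ s') → (∀ i → i ∈ s' → i ∈ s) → (∀ i → next s i ≡ next s' i) → s ≡ s'
  next-injective [] [] _ _ _ _ _ = refl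
  next-injective [] (y ∷ _) _ _ _ s'⊆s _ with s'⊆s y (here refl)
  ... | ()
  next-injective (x ∷ _) [] _ _ s⊆s' _ _ with s⊆s' x (here refl)
  ... | ()
  next-injective (x ∷ u) (y ∷ u') uniq@(_ ∷ uniqU) uniq'@(_ ∷ uniqU') s⊆s' s'⊆s same with x ≟ y
  ... | yes refl = cong (x ∷_) (next-injective u u' uniqU uniqU' (shrink uniq s⊆s') (shrink uniq' s'⊆s) same')
    where
    shrink : ∀ {v v'} → Unique (x ∷ v) → (∀ i → i ∈ x ∷ v → i ∈ x ∷ v') → ∀ i → i ∈ v → i ∈ v'
    shrink uniqV incl i i∈v with incl i (there i∈v)
    ... | here refl = ⊥-elim (Unique[x∷xs]⇒x∉xs uniqV i∈v)
    ... | there i∈v' = i∈v'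
    same' : ∀ i → next u i ≡ next u' i
    same' i with i ≟ x
    ... | yes refl = trans (next-∉ u (Unique[x∷xs]⇒x∉xs uniq)) (sym (next-∉ u' (Unique[x∷xs]⇒x∉xs uniq')))
    ... | no i≢x   = trans (sym (next-other u (i≢x ∘ sym))) (trans (same i) (next-other u' (i≢x ∘ sym)))
  ... | no x≢y with s⊆s' x (here refl)
  ... | here x≡y    = ⊥-elim (x≢y x≡y)
  ... | there x∈u' with predecessor y u' x uniq' x∈u'
  ... | p , eq = ⊥-elim (head-no-predecessor x u p uniq (trans (same p) eq))

missing-shorter : ∀ {B : Set} (_≟B_ : DecidableEquality B) {i : B} (t G : List B) →
  Unique t → (∀ {x} → x ∈ t → x ∈ G) → i ∈ G → i ∉ t → suc (length t) ≤ length G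
missing-shorter _≟B_ {i} t G uniq t⊆G i∈G i∉t = begin
    suc (length t)                      ≡⟨ cong suc (sym (sum-ones t)) ⟩
    suc (sum (map (λ _ → 1) t))         ≤⟨ s≤s (sum-≤-injection _≟B_ (λ _ → 1) (λ _ → 1) (λ x → x) t (delete _≟B_ i G)
                                              uniq (λ _ _ x≡y → x≡y)
                                              (λ x∈t → ∈-delete _≟B_ G (t⊆G x∈t) (λ x≡i → i∉t (subst (_∈ t) x≡i x∈t)))
                                              (λ _ → ≤-refl)) ⟩
    suc (sum (map (λ _ → 1) (delete _≟B_ i G))) ≡⟨ sym (sum-delete _≟B_ (λ _ → 1) G i∈G) ⟩
    sum (map (λ _ → 1) G)               ≡⟨ sum-ones G ⟩
    length G                            ∎
  where
  open ≤-Reasoning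
  sum-ones : ∀ {A : Set} (xs : List A) → sum (map (λ _ → 1) xs) ≡ length xs
  sum-ones []       = refl
  sum-ones (x ∷ xs) = cong suc (sum-ones xs)

∏-update : ∀ {n} (F G : Fin n → ℕ) (x : Fin n) → (∀ i → i ≢ x → F i ≡ G i) →
  ∏ F * G x ≡ ∏ G * F x
∏-update {suc n} F G zero agree =
  trans (cong (λ w → F zero * w * G zero) (∏-cong-≗ (λ i → agree (suc i) (λ ())))) (swap (F zero) (G zero) _)
  where
  swap : ∀ a b c → a * c * b ≡ b * c * a
  swap = solve-∀
∏-update {suc n} F G (suc x) agree =
  trans (*-assoc (F zero) _ _)
    (trans (cong₂ _*_ (agree zero (λ ())) (∏-update (F ∘ suc) (G ∘ suc) x (λ i i≢x → agree (suc i) (i≢x ∘ Fin.suc-injective))))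
      (sym (*-assoc (G zero) _ _)))

module _ {r : ℕ} (w : Fin r → Fin r → ℕ) where

  pathWeight : List (Fin r) → ℕ
  pathWeight (i ∷ j ∷ is) = w i j * pathWeight (j ∷ is)
  pathWeight _            = 1

  -- w with its diagonal set to 0 (a permutation never steps from i to i).
  offDiagonal : Fin r → Fin r → ℕ
  offDiagonal i j with i ≟ j
  ... | yes _ = 0
  ... | no _  = w i j

  offDiagonal-≢ : ∀ {i j} → i ≢ j → offDiagonal i j ≡ w i j
  offDiagonal-≢ {i} {j} i≢j with i ≟ j
  ... | yes i≡j = ⊥-elim (i≢j i≡j)
  ... | no _    = refl

  stepWeight : Fin r → Maybe (Fin r) → ℕ
  stepWeight i nothing  = 1
  stepWeight i (just j) = offDiagonal i j

  -- Induction on t: prepending x changes the successor map only at x.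
  pathWeight-factorises : ∀ t → Unique t → pathWeight t ≡ ∏ (λ i → stepWeight i (next t i))
  pathWeight-factorises []      _ = sym (∏-ones r)
  pathWeight-factorises (x ∷ t) uniq@(_ ∷ uniqT) = sym (begin
      ∏ after                            ≡⟨ sym (*-identityʳ _) ⟩
      ∏ after * 1                        ≡⟨ cong (∏ after *_) (sym (cong (stepWeight x) (next-∉ t x∉t))) ⟩
      ∏ after * before x                 ≡⟨ ∏-update after before x (λ i i≢x → cong (stepWeight i) (next-other t (i≢x ∘ sym))) ⟩
      ∏ before * after x                 ≡⟨ cong₂ _*_ (sym (pathWeight-factorises t uniqT)) (cong (stepWeight x) (next-self x t)) ⟩
      pathWeight t * stepWeight x (head t) ≡⟨ prepend t x∉t ⟩
      pathWeight (x ∷ t)                 ∎)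
    where
    open ≡-Reasoning
    x∉t : x ∉ t
    x∉t = Unique[x∷xs]⇒x∉xs uniq
    after before : Fin r → ℕ
    after  i = stepWeight i (next (x ∷ t) i)
    before i = stepWeight i (next t i)
    prepend : ∀ t → x ∉ t → pathWeight t * stepWeight x (head t) ≡ pathWeight (x ∷ t)
    prepend []      _   = refl
    prepend (y ∷ u) x∉t = trans (cong (pathWeight (y ∷ u) *_) (offDiagonal-≢ (x∉t ∘ here)))
                                (*-comm (pathWeight (y ∷ u)) (w x y))

module _ {A : Set} (O : List A) where

  vectorsOver : ∀ k → List (Vec A k)
  vectorsOver zero    = Vec.[] ∷ []
  vectorsOver (suc k) = cartesianProductWith Vec._∷_ O (vectorsOver k)

  ∈-vectorsOver : (∀ a → a ∈ O) → ∀ {k} (v : Vec A k) → v ∈ vectorsOver k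
  ∈-vectorsOver complete Vec.[]      = here refl
  ∈-vectorsOver complete (a Vec.∷ v) = ∈-cartesianProductWith⁺ Vec._∷_ (complete a) (∈-vectorsOver complete v)

  coordinateProduct : ∀ {k} → (Fin k → A → ℕ) → Vec A k → ℕ
  coordinateProduct B Vec.[]      = 1
  coordinateProduct B (a Vec.∷ v) = B zero a * coordinateProduct (B ∘ suc) v

  coordinateProduct-tabulate : ∀ {k} (B : Fin k → A → ℕ) (f : Fin k → A) →
    coordinateProduct B (Vec.tabulate f) ≡ ∏ (λ i → B i (f i))
  coordinateProduct-tabulate {zero}  B f = refl
  coordinateProduct-tabulate {suc k} B f = cong (B zero (f zero) *_) (coordinateProduct-tabulate (B ∘ suc) (f ∘ suc))

  sum-coordinateProduct : ∀ {k} (B : Fin k → A → ℕ) →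
    sum (map (coordinateProduct B) (vectorsOver k)) ≡ ∏ (λ i → sum (map (B i) O))
  sum-coordinateProduct {zero}  B = refl
  sum-coordinateProduct {suc k} B = begin
      sum (map (coordinateProduct B) (cartesianProductWith Vec._∷_ O (vectorsOver k)))
        ≡⟨ sum-cartesianProductWith Vec._∷_ (coordinateProduct B) O (vectorsOver k) ⟩
      sum (map (λ a → sum (map (λ v → B zero a * coordinateProduct (B ∘ suc) v) (vectorsOver k))) O)
        ≡⟨ cong sum (List.map-cong (λ a → sum-map-*ˡ (B zero a) (coordinateProduct (B ∘ suc)) (vectorsOver k)) O) ⟩
      sum (map (λ a → B zero a * sum (map (coordinateProduct (B ∘ suc)) (vectorsOver k))) O)
        ≡⟨ sum-map-*ʳ _ (B zero) O ⟩
      sum (map (B zero) O) * sum (map (coordinateProduct (B ∘ suc)) (vectorsOver k))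
        ≡⟨ cong (sum (map (B zero) O) *_) (sum-coordinateProduct (B ∘ suc)) ⟩
      sum (map (B zero) O) * ∏ (λ i → sum (map (B (suc i)) O)) ∎
    where open ≡-Reasoning

-- The members of S_r: tuples r k lists every k-tuple over Fin r exactly
-- once, and a permutation is a duplicate-free r-tuple, which therefore
-- contains every element of Fin r.
tuples-step : ∀ r k → tuples r (suc k) ≡ cartesianProductWith _∷_ (allFin r) (tuples r k)
tuples-step r k = go (allFin r)
  where
  go : ∀ L → concatMap (λ i → map (i ∷_) (tuples r k)) L ≡ cartesianProductWith _∷_ L (tuples r k)
  go []      = refl
  go (x ∷ L) = cong (map (x ∷_) (tuples r k) ++_) (go L)

tuples-unique : ∀ r k → Unique (tuples r k)
tuples-unique r zero    = All.[] ∷ AllPairs.[]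
tuples-unique r (suc k) = subst Unique (sym (tuples-step r k))
  (cartesianProductWith⁺ _∷_ List.∷-injective (allFin⁺ r) (tuples-unique r k))

tuples-length : ∀ r k {t} → t ∈ tuples r k → length t ≡ k
tuples-length r zero    (here refl) = refl
tuples-length r (suc k) {t} t∈ with ∈-cartesianProductWith⁻ _∷_ (allFin r) (tuples r k) (subst (t ∈_) (tuples-step r k) t∈)
... | _ , u , _ , u∈ , refl = cong suc (tuples-length r k u∈)

permutations-unique : ∀ r → Unique (permutations r)
permutations-unique r = filter⁺ _ (tuples-unique r r)

permutation-unique : ∀ r {t} → t ∈ permutations r → Unique t
permutation-unique r t∈ = proj₂ (∈-filter⁻ _ {xs = tuples r r} t∈)

permutation-complete : ∀ r {t} → t ∈ permutations r → ∀ i → i ∈ t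
permutation-complete r {t} t∈ i with DecMembership._∈?_ _≟_ i t
... | yes i∈t = i∈t
... | no  i∉t = ⊥-elim (<-irrefl lengths (missing-shorter _≟_ t (allFin r) (permutation-unique r t∈) (λ {x} _ → ∈-allFin x) (∈-allFin i) i∉t))
  where
  lengths : length t ≡ length (allFin r)
  lengths = trans (tuples-length r r (proj₁ (∈-filter⁻ _ {xs = tuples r r} t∈))) (sym (List.length-tabulate (λ j → j)))

choices : (r : ℕ) → List (Maybe (Fin r))
choices r = nothing ∷ map just (allFin r)

choices-complete : ∀ {r} (c : Maybe (Fin r)) → c ∈ choices r
choices-complete nothing  = here refl
choices-complete (just j) = there (∈-map⁺ just (∈-allFin j))

sum-choices : ∀ {r} (w : Fin r → Fin r → ℕ) i →
  sum (map (stepWeight w i) (choices r)) ≡ 1 + ∑ (offDiagonal w i)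
sum-choices {r} w i = cong suc (trans (cong sum (sym (List.map-∘ (allFin r)))) (sum-allFin (offDiagonal w i)))

-- The combinatorial heart: encoding a permutation by its successor map is
-- injective, so the path weights over S_r sum to at most the sum over all
-- successor assignments, which factorises as a product over vertices:
--   ∑_{π ∈ S_r} w π₁ π₂ ⋯ w π_{r-1} π_r  ≤  ∏_i (1 + ∑_{j ≠ i} w i j).
permutation-bound : ∀ {r} (w : Fin r → Fin r → ℕ) →
  sum (map (pathWeight w) (permutations r)) ≤ ∏ (λ i → 1 + ∑ (offDiagonal w i))
permutation-bound {r} w =
  subst (sum (map (pathWeight w) (permutations r)) ≤_)
        (trans (sum-coordinateProduct (choices r) (stepWeight w)) (∏-cong-≗ (sum-choices w)))
        (sum-≤-injection (Vec.≡-dec (Maybe.≡-dec _≟_)) (pathWeight w) (coordinateProduct (choices r) (stepWeight w))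
           successorCode (permutations r) (vectorsOver (choices r) r) (permutations-unique r)
           code-injective (λ _ → ∈-vectorsOver (choices r) choices-complete _) (≤-reflexive ∘ code-weight))
  where
  successorCode : List (Fin r) → Vec (Maybe (Fin r)) r
  successorCode t = Vec.tabulate (next t)

  code-weight : ∀ {t} → t ∈ permutations r →
    pathWeight w t ≡ coordinateProduct (choices r) (stepWeight w) (successorCode t)
  code-weight {t} t∈ = trans (pathWeight-factorises w t (permutation-unique r t∈))
                             (sym (coordinateProduct-tabulate (choices r) (stepWeight w) (next t)))

  code-injective : ∀ {s t} → s ∈ permutations r → t ∈ permutations r → successorCode s ≡ successorCode t → s ≡ t
  code-injective {s} {t} s∈ t∈ same =
    next-injective s t (permutation-unique r s∈) (permutation-unique r t∈)
      (λ i _ → permutation-complete r t∈ i) (λ i _ → permutation-complete r s∈ i)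
      (λ i → trans (sym (Vec.lookup∘tabulate (next s) i))
               (trans (cong (λ v → Vec.lookup v i) same) (Vec.lookup∘tabulate (next t) i)))

<ᵇ-true : ∀ {m n} → m < n → (m <ᵇ n) ≡ true
<ᵇ-true {m} {n} m<n with m <ᵇ n in eq
... | true  = refl
... | false = ⊥-elim (subst T eq (<⇒<ᵇ m<n))

<ᵇ-false : ∀ {m n} → n ≤ m → (m <ᵇ n) ≡ false
<ᵇ-false {m} {n} n≤m with m <ᵇ n in eq
... | false = refl
... | true  = ⊥-elim (≤⇒≯ n≤m (<ᵇ⇒< m n (subst T (sym eq) tt)))

module _ {r : ℕ} (w : Fin r → Fin r → ℕ) where

  upper : Fin r → Fin r → ℕ
  upper i j = if toℕ i <ᵇ toℕ j then w i j else 0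

  offDiagonal-split : (∀ i j → w i j ≡ w j i) → ∀ i j → offDiagonal w i j ≡ upper i j + upper j i
  offDiagonal-split symm i j with i ≟ j
  ... | yes refl rewrite <ᵇ-false (≤-refl {toℕ i}) = refl
  ... | no i≢j with <-cmp (toℕ i) (toℕ j)
  ... | tri< i<j _ _ rewrite <ᵇ-true i<j | <ᵇ-false (<⇒≤ i<j) = sym (+-identityʳ _)
  ... | tri≈ _ i≡j _ = ⊥-elim (i≢j (Fin.toℕ-injective i≡j))
  ... | tri> _ _ j<i rewrite <ᵇ-true j<i | <ᵇ-false (<⇒≤ j<i) = symm i j

  degree-sum : (∀ i j → w i j ≡ w j i) →
    ∑ (λ i → 1 + ∑ (offDiagonal w i)) ≡ 2 * ∑ (λ i → ∑ (upper i)) + r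
  degree-sum symm = begin
      ∑ (λ i → 1 + ∑ (offDiagonal w i))                        ≡⟨ ∑-distrib-+ (λ _ → 1) (λ i → ∑ (offDiagonal w i)) ⟩
      ∑ {r} (λ _ → 1) + ∑ (λ i → ∑ (offDiagonal w i))          ≡⟨ cong₂ _+_ (∑-ones r) (sum-cong-≗ (λ i → sum-cong-≗ (offDiagonal-split symm i))) ⟩
      r + ∑ (λ i → ∑ (λ j → upper i j + upper j i))            ≡⟨ cong (r +_) (sum-cong-≗ (λ i → ∑-distrib-+ (upper i) (λ j → upper j i))) ⟩
      r + ∑ (λ i → ∑ (upper i) + ∑ (λ j → upper j i))          ≡⟨ cong (r +_) (∑-distrib-+ (λ i → ∑ (upper i)) (λ i → ∑ (λ j → upper j i))) ⟩
      r + (S + ∑ (λ i → ∑ (λ j → upper j i)))                   ≡⟨ cong (λ x → r + (S + x)) (∑-comm (λ i j → upper j i)) ⟩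
      r + (S + S)                                               ≡⟨ rearrange r S ⟩
      2 * S + r                                                 ∎
    where
    open ≡-Reasoning
    S = ∑ (λ i → ∑ (upper i))
    ∑-ones : ∀ n → ∑ {n} (λ _ → 1) ≡ n
    ∑-ones zero    = refl
    ∑-ones (suc n) = cong suc (∑-ones n)
    rearrange : ∀ r S → r + (S + S) ≡ 2 * S + r
    rearrange = solve-∀

overlapSize : ∀ {r n} → (Fin r → Subset n) → Fin r → Fin r → ℕ
overlapSize C i j = ∣ C i ∩ C j ∣

overlapSize-symmetric : ∀ {r n} (C : Fin r → Subset n) i j → overlapSize C i j ≡ overlapSize C j i
overlapSize-symmetric C i j = cong ∣_∣ (∩-comm (C i) (C j))

chainProduct-pathWeight : ∀ {r n} (C : Fin r → Subset n) t → chainProduct C t ≡ pathWeight (overlapSize C) t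
chainProduct-pathWeight C []           = refl
chainProduct-pathWeight C (i ∷ [])     = refl
chainProduct-pathWeight C (i ∷ j ∷ is) = cong (overlapSize C i j *_) (chainProduct-pathWeight C (j ∷ is))

pairSum-upper : ∀ {r n} (C : Fin r → Subset n) → pairSum C ≡ ∑ (λ i → ∑ (upper (overlapSize C) i))
pairSum-upper {r} C = begin
    pairSum C ≡⟨ sum-filter _ _ (cartesianProduct (allFin r) (allFin r)) ⟩
    sum (map (λ { (i , j) → upper (overlapSize C) i j }) (cartesianProduct (allFin r) (allFin r)))
      ≡⟨ sum-cartesianProductWith _,_ _ (allFin r) (allFin r) ⟩
    sum (map (λ i → sum (map (upper (overlapSize C) i) (allFin r))) (allFin r))
      ≡⟨ cong sum (List.map-cong (λ i → sum-allFin (upper (overlapSize C) i)) (allFin r)) ⟩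
    sum (map (λ i → ∑ (upper (overlapSize C) i)) (allFin r))
      ≡⟨ sum-allFin (λ i → ∑ (upper (overlapSize C) i)) ⟩
    ∑ (λ i → ∑ (upper (overlapSize C) i)) ∎
  where open ≡-Reasoning

-- The statement compares the rationals P/1 and (T/r)^r; this
-- reduces to r^r * P ≤ T^r by tracking numerator/denominator pairs through
-- the unnormalised rationals, where multiplication is componentwise.
module Rational where
  open import Data.Integer as ℤ using (+_)
  import Data.Integer.Properties as ℤ
  open import Data.Integer.Tactic.RingSolver using () renaming (solve-∀ to solve-∀ᶻ)
  import Data.Integer.GCD
  open import Data.Rational as ℚ using (mkℚ; _/_)
  import Data.Rational.Properties as ℚ
  open import Data.Rational.Unnormalised as ℚᵘ using (ℚᵘ; mkℚᵘ; ↥_; ↧_)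
  import Data.Nat as ℕ

  -- u is the fraction m / d (d need not be reduced).
  record _represents_/_ (u : ℚᵘ) (m d : ℕ) : Set where
    constructor cross
    field cross-eq : ↥ u ℤ.* + d ≡ + m ℤ.* ↧ u

  fraction-represents : ∀ m d .{{_ : NonZero d}} → ℚ.toℚᵘ ((+ m) / d) represents m / d
  fraction-represents m d with (+ m) / d in eq
  ... | q@(mkℚ _ _ _) = cross (begin
      ℚ.↥ q ℤ.* + d               ≡⟨ cong (ℚ.↥ q ℤ.*_) (sym (subst (λ x → ℚ.↧ x ℤ.* g ≡ + d) eq (ℚ.↧-/ (+ m) d))) ⟩
      ℚ.↥ q ℤ.* (ℚ.↧ q ℤ.* g)     ≡⟨ exchange (ℚ.↥ q) (ℚ.↧ q) g ⟩
      (ℚ.↥ q ℤ.* g) ℤ.* ℚ.↧ q     ≡⟨ cong (ℤ._* ℚ.↧ q) (subst (λ x → ℚ.↥ x ℤ.* g ≡ + m) eq (ℚ.↥-/ (+ m) d)) ⟩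
      + m ℤ.* ℚ.↧ q               ∎)
    where
    open ≡-Reasoning
    g = Data.Integer.GCD.gcd (+ m) (+ d)
    exchange : ∀ a b c → a ℤ.* (b ℤ.* c) ≡ (a ℤ.* c) ℤ.* b
    exchange = solve-∀ᶻ

  represents-≃ : ∀ {u v m d} → u ℚᵘ.≃ v → v represents m / d → u represents m / d
  represents-≃ {mkℚᵘ a b} {mkℚᵘ c e} {m} {d} (ℚᵘ.*≡* a·e≡c·b) (cross c·d≡m·e) =
    cross (ℤ.*-cancelʳ-≡ _ _ (+ suc e) (begin
      a ℤ.* + d ℤ.* + suc e         ≡⟨ swap a (+ d) (+ suc e) ⟩
      a ℤ.* + suc e ℤ.* + d         ≡⟨ cong (ℤ._* + d) a·e≡c·b ⟩
      c ℤ.* + suc b ℤ.* + d         ≡⟨ swap c (+ suc b) (+ d) ⟩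
      c ℤ.* + d ℤ.* + suc b         ≡⟨ cong (ℤ._* + suc b) c·d≡m·e ⟩
      + m ℤ.* + suc e ℤ.* + suc b   ≡⟨ swap (+ m) (+ suc e) (+ suc b) ⟩
      + m ℤ.* + suc b ℤ.* + suc e   ∎))
    where
    open ≡-Reasoning
    swap : ∀ x y z → x ℤ.* y ℤ.* z ≡ x ℤ.* z ℤ.* y
    swap = solve-∀ᶻ

  represents-* : ∀ {u v m d m' d'} → u represents m / d → v represents m' / d' →
    (u ℚᵘ.* v) represents (m ℕ.* m') / (d ℕ.* d')
  represents-* {mkℚᵘ a b} {mkℚᵘ c e} {m} {d} {m'} {d'} (cross a·d≡m·b) (cross c·d'≡m'·e) = cross (begin
      a ℤ.* c ℤ.* + (d ℕ.* d')                  ≡⟨ cong (a ℤ.* c ℤ.*_) (ℤ.pos-* d d') ⟩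
      a ℤ.* c ℤ.* (+ d ℤ.* + d')                ≡⟨ interchange a c (+ d) (+ d') ⟩
      (a ℤ.* + d) ℤ.* (c ℤ.* + d')              ≡⟨ cong₂ ℤ._*_ a·d≡m·b c·d'≡m'·e ⟩
      (+ m ℤ.* + suc b) ℤ.* (+ m' ℤ.* + suc e)  ≡⟨ interchange (+ m) (+ suc b) (+ m') (+ suc e) ⟩
      (+ m ℤ.* + m') ℤ.* (+ suc b ℤ.* + suc e)  ≡⟨ cong₂ ℤ._*_ (sym (ℤ.pos-* m m')) (sym (ℤ.pos-* (suc b) (suc e))) ⟩
      + (m ℕ.* m') ℤ.* + (suc b ℕ.* suc e)      ∎)
    where
    open ≡-Reasoning
    interchange : ∀ x y z w → x ℤ.* y ℤ.* (z ℤ.* w) ≡ (x ℤ.* z) ℤ.* (y ℤ.* w)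
    interchange = solve-∀ᶻ

  power-represents : ∀ T r .{{_ : NonZero r}} k → ℚ.toℚᵘ (((+ T) / r) ^ℚ k) represents (T ^ k) / (r ^ k)
  power-represents T r zero    = cross refl
  power-represents T r (suc k) =
    represents-≃ (ℚ.toℚᵘ-homo-* q (q ^ℚ k))
      (represents-* (fraction-represents T r) (power-represents T r k))
    where
    q = (+ T) / r

  represents-≤ : ∀ {u v m d m' d'} → u represents m / suc d → v represents m' / suc d' →
    m ℕ.* suc d' ℕ.≤ m' ℕ.* suc d → u ℚᵘ.≤ v
  represents-≤ {mkℚᵘ a b} {mkℚᵘ c e} {m} {d} {m'} {d'} (cross a·d≡m·b) (cross c·d'≡m'·e) m·d'≤m'·d =
    ℚᵘ.*≤* (ℤ.*-cancelʳ-≤-pos _ _ (+ suc d ℤ.* + suc d') (begin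
      a ℤ.* + suc e ℤ.* (+ suc d ℤ.* + suc d')        ≡⟨ xyzw≡xzyw a (+ suc e) (+ suc d) (+ suc d') ⟩
      (a ℤ.* + suc d) ℤ.* (+ suc e ℤ.* + suc d')      ≡⟨ cong (ℤ._* (+ suc e ℤ.* + suc d')) a·d≡m·b ⟩
      + m ℤ.* + suc b ℤ.* (+ suc e ℤ.* + suc d')      ≡⟨ xyzw≡xwyz (+ m) (+ suc b) (+ suc e) (+ suc d') ⟩
      + m ℤ.* + suc d' ℤ.* (+ suc b ℤ.* + suc e)      ≡⟨ cong (ℤ._* (+ suc b ℤ.* + suc e)) (sym (ℤ.pos-* m (suc d'))) ⟩
      + (m ℕ.* suc d') ℤ.* (+ suc b ℤ.* + suc e)      ≤⟨ ℤ.*-monoʳ-≤-nonNeg (+ suc b ℤ.* + suc e) (ℤ.+≤+ m·d'≤m'·d) ⟩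
      + (m' ℕ.* suc d) ℤ.* (+ suc b ℤ.* + suc e)      ≡⟨ cong (ℤ._* (+ suc b ℤ.* + suc e)) (ℤ.pos-* m' (suc d)) ⟩
      + m' ℤ.* + suc d ℤ.* (+ suc b ℤ.* + suc e)      ≡⟨ xyzw≡xwzy (+ m') (+ suc d) (+ suc b) (+ suc e) ⟩
      (+ m' ℤ.* + suc e) ℤ.* (+ suc b ℤ.* + suc d)    ≡⟨ cong (ℤ._* (+ suc b ℤ.* + suc d)) (sym c·d'≡m'·e) ⟩
      (c ℤ.* + suc d') ℤ.* (+ suc b ℤ.* + suc d)      ≡⟨ xyzw≡xzwy c (+ suc d') (+ suc b) (+ suc d) ⟩
      c ℤ.* + suc b ℤ.* (+ suc d ℤ.* + suc d')        ∎))
    where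
    open ℤ.≤-Reasoning
    xyzw≡xzyw : ∀ x y z w → x ℤ.* y ℤ.* (z ℤ.* w) ≡ x ℤ.* z ℤ.* (y ℤ.* w)
    xyzw≡xzyw = solve-∀ᶻ
    xyzw≡xwyz : ∀ x y z w → x ℤ.* y ℤ.* (z ℤ.* w) ≡ x ℤ.* w ℤ.* (y ℤ.* z)
    xyzw≡xwyz = solve-∀ᶻ
    xyzw≡xwzy : ∀ x y z w → x ℤ.* y ℤ.* (z ℤ.* w) ≡ x ℤ.* w ℤ.* (z ℤ.* y)
    xyzw≡xwzy = solve-∀ᶻ
    xyzw≡xzwy : ∀ x y z w → x ℤ.* y ℤ.* (z ℤ.* w) ≡ x ℤ.* z ℤ.* (w ℤ.* y)
    xyzw≡xzwy = solve-∀ᶻ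

  ≤-power : ∀ P T r .{{_ : NonZero r}} → r ^ r * P ≤ T ^ r → (+ P) / 1 ℚ.≤ ((+ T) / r) ^ℚ r
  ≤-power P T r bound with r ^ r | m^n>0 r r | power-represents T r r | bound
  ... | suc d | _ | powerRep | bound′ =
    ℚ.toℚᵘ-cancel-≤ (represents-≤ (fraction-represents P 1) powerRep
                      (subst₂ _≤_ (*-comm (suc d) P) (sym (*-identityʳ _)) bound′))

permSum-bound : ∀ {r n} (C : Fin r → Subset n) → r ^ r * permSum C ≤ (2 * pairSum C + r) ^ r
permSum-bound {r} C = begin
    r ^ r * permSum C                                   ≡⟨ cong (λ s → r ^ r * sum s) (List.map-cong (chainProduct-pathWeight C) (permutations r)) ⟩
    r ^ r * sum (map (pathWeight w) (permutations r))   ≤⟨ *-monoʳ-≤ (r ^ r) (permutation-bound w) ⟩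
    r ^ r * ∏ (λ i → 1 + ∑ (offDiagonal w i))           ≤⟨ amgm r (λ i → 1 + ∑ (offDiagonal w i)) ⟩
    ∑ (λ i → 1 + ∑ (offDiagonal w i)) ^ r               ≡⟨ cong (_^ r) (degree-sum w (overlapSize-symmetric C)) ⟩
    (2 * ∑ (λ i → ∑ (upper w i)) + r) ^ r               ≡⟨ cong (λ s → (2 * s + r) ^ r) (sym (pairSum-upper C)) ⟩
    (2 * pairSum C + r) ^ r                             ∎
  where
  open ≤-Reasoning
  w = overlapSize C

lemma2 : (r n : ℕ) (h : 2 ≤ r) (C : Fin r → Subset n) →
    ℕtoℚ (permSum C) ≤ℚ (divBy (2 * pairSum C + r) r h ^ℚ r)
lemma2 r n h C = Rational.≤-power (permSum C) (2 * pairSum C + r) r {{>-nonZero (≤-trans (s≤s z≤n) h)}} (permSum-bound C)
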